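{- Let $\delta>0$ be a constant, let $\bar{s}$ be an offline string of length $n$ and $s$ an online string of length $n^{\gamma}$ with $\gamma>0$. Consider the following recursive algorithm $\mathcal{A}(s)$ (with $\bar{s}$, $n$ and $\delta$ fixed): if $|s|\le n^{\delta}$, store $s$ entirely, find indices $l,r$ such that $\bar{s}[l,r]$ minimizes $\mathrm{ed}(\bar{s}[l,r],s)$ over all substrings of $\bar{s}$, and return $(l,r,d)$ with $d=\mathrm{ed}(\bar{s}[l,r],s)$. Otherwise set $\xi=n^{\delta}$, split $s$ into $\xi$ consecutive windows $s^*_1,\dots,s^*_\xi$ of equal length $|s|/\xi$, and as each window streams in, apply $\mathcal{A}$ recursively to it, obtaining $(l_i,r_i,d_i)$; then, over all integer tuples $1\le p_0\le p_1\le\dots\le p_\xi\le n+1$, compute $$dist=\sum_{i=1}^{\xi}\Big(d_i+\mathrm{ed}\big(\bar{s}[p_{i-1},p_i),\bar{s}[l_i,r_i]\big)\Big),$$ and return $(l,r,d)=(p_0,\;p_\xi-1,\;\text{the minimum value of }dist)$ for a minimizing tuple. Then the output $(l,r,d)$ of $\mathcal{A}(s)$ is an $O(2^{\gamma/\delta})$-approximation for the closest substring problem, i.e. there is $\alpha=O(2^{\gamma/\delta})$ such that for every substring $\bar{s}[l^*,r^*]$ of $\bar{s}$, $$\mathrm{ed}(\bar{s}[l,r],s)\le d\le \alpha\cdot\mathrm{ed}(\bar{s}[l^*,r^*],s).$$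
   Context: For a string $x$, $x[i,j]$ is the substring from the $i$-th to the $j$-th character and $x[i,j)$ the substring from the $i$-th to the $(j-1)$-th character ($x[i,i)$ is empty). $\mathrm{ed}(x,y)$ is the edit distance (minimum number of insertions, deletions and substitutions transforming $x$ into $y$). The algorithm has random access to $\bar{s}$ and receives $s$ as a stream. The closest substring problem asks for indices $l,r$ and the value $\mathrm{ed}(\bar{s}[l,r],s)$ such that $\bar{s}[l,r]$ has minimum edit distance to $s$ among all substrings of $\bar{s}$. -}

module Defs where

open import Data.Nat using (ℕ; zero; suc; _+_; _*_; _∸_; _≤_; _<_; _⊓_)
open import Data.List using (List; []; _∷_; length; take; drop; concat)
open import Data.Vec using (Vec; lookup; toList; tabulate; sum)
open import Data.Fin using (Fin; fromℕ; inject₁) renaming (zero to fzero; suc to fsuc)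
open import Data.Product using (_×_; _,_)
open import Relation.Binary.Definitions using (DecidableEquality)
open import Relation.Binary.PropositionalEquality using (_≡_)
open import Relation.Nullary using (yes; no)

module _ {A : Set} (_≟_ : DecidableEquality A) where

  cost : A → A → ℕ
  cost x y with x ≟ y
  ... | yes _ = 0
  ... | no  _ = 1

  ed : List A → List A → ℕ
  ed [] ys = length ys
  ed (x ∷ xs) [] = suc (length xs)
  ed (x ∷ xs) (y ∷ ys) =
    (suc (ed xs (y ∷ ys)) ⊓ suc (ed (x ∷ xs) ys)) ⊓ (cost x y + ed xs ys)

-- 1-based indexing.  x[i,j] : characters i..j (empty when j = i - 1).
sub : {A : Set} → List A → ℕ → ℕ → List A
sub x i j = take (suc j ∸ i) (drop (i ∸ 1) x)

-- x[i,j) : characters i..j-1 (empty when j = i).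
subHO : {A : Set} → List A → ℕ → ℕ → List A
subHO x i j = take (j ∸ i) (drop (i ∸ 1) x)

-- (l , r) designates a substring x[l,r] of a string of length n
-- (1 ≤ l ≤ r + 1 ≤ n + 1; l = r + 1 is the empty substring).
ValidSub : ℕ → ℕ → ℕ → Set
ValidSub n l r = (1 ≤ l) × (l ≤ suc r) × (r ≤ n)

Triple : Set
Triple = ℕ × ℕ × ℕ

AdmissibleTuple : (n ξ : ℕ) → (Fin (suc ξ) → ℕ) → Set
AdmissibleTuple n ξ p =
  (1 ≤ p fzero) × ((i : Fin ξ) → p (inject₁ i) ≤ p (fsuc i)) × (p (fromℕ ξ) ≤ suc n)

module Algorithm {A : Set} (_≟_ : DecidableEquality A) (ξ : ℕ) (s̄ : List A) where

  n : ℕ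
  n = length s̄

  dist : Vec Triple ξ → (Fin (suc ξ) → ℕ) → ℕ
  dist os p = sum (tabulate λ (i : Fin ξ) → step (lookup os i) i)
    where
      step : Triple → Fin ξ → ℕ
      step (lᵢ , rᵢ , dᵢ) i = dᵢ + ed _≟_ (subHO s̄ (p (inject₁ i)) (p (fsuc i))) (sub s̄ lᵢ rᵢ)

  -- Out s (l , r , d) : (l , r , d) is a possible output of 𝒜(s)
  -- (any tie-breaking among minimizers is allowed).
  data Out : List A → Triple → Set where
    base : ∀ {s l r} → length s ≤ ξ → ValidSub n l r
         → (∀ l' r' → ValidSub n l' r' → ed _≟_ (sub s̄ l r) s ≤ ed _≟_ (sub s̄ l' r') s)
         → Out s (l , r , ed _≟_ (sub s̄ l r) s)
    split : ∀ {s} (m : ℕ) (ws : Vec (List A) ξ) (os : Vec Triple ξ) (p : Fin (suc ξ) → ℕ)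
          → ξ < length s
          → s ≡ concat (toList ws)
          → (∀ i → length (lookup ws i) ≡ m)
          → (∀ i → Out (lookup ws i) (lookup os i))
          → AdmissibleTuple n ξ p
          → (∀ p' → AdmissibleTuple n ξ p' → dist os p ≤ dist os p')
          → Out s (p fzero , p (fromℕ ξ) ∸ 1 , dist os p)

module Submission where

open import Defs
open import Data.Nat
open import Data.Nat.Properties
open import Data.Nat.Tactic.RingSolver using (solve-∀)
open import Data.List using (List; []; _∷_; length; _++_; take; drop; concat)
open import Data.List.Properties using (length-++; ++-identityʳ; drop-drop; ∷-injective)
open import Data.Vec using (Vec; lookup; toList; tabulate; sum)
open import Data.Vec.Properties using (tabulate∘lookup)
open import Data.Fin using (Fin; fromℕ; inject₁) renaming (zero to fzero; suc to fsuc)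
open import Data.Product using (Σ; Σ-syntax; ∃₂; _×_; _,_)
open import Data.Sum using (inj₁; inj₂)
open import Function using (_∘_)
open import Relation.Binary.PropositionalEquality
open import Relation.Binary.Definitions using (DecidableEquality)
open import Relation.Nullary using (yes; no; contradiction)

-- Write ed* for ed(s̄[l*,r*], s).  Induction on the recursion proves the stronger bound
-- d + ed* ≤ 2^(k+1)·ed* whenever |s| ≤ ξ^k.  In a split step, an optimal alignment of s̄[l*,r*]
-- with s = s*₁⋯s*_ξ cuts it into pieces tᵢ with Σ eᵢ ≤ ed*, where eᵢ = ed(tᵢ, s*ᵢ), and the cut
-- points form an admissible tuple q.  By the triangle inequality the i-th term of dist(q) is at
-- most 2dᵢ + eᵢ, and the inductive bound dᵢ + eᵢ ≤ 2^(k+1)·eᵢ for window i turns this into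
-- dist(q) + Σ eᵢ ≤ 2^(k+2)·Σ eᵢ.  Since p minimises dist, the same holds for dist(p), and then
-- also with ed* in place of Σ eᵢ.

Monotone : ∀ {N} → (Fin (suc N) → ℕ) → Set
Monotone {N} q = (i : Fin N) → q (inject₁ i) ≤ q (fsuc i)

monotone-first≤ : ∀ {N} (q : Fin (suc N) → ℕ) → Monotone q → ∀ j → q fzero ≤ q j
monotone-first≤ q mono fzero = ≤-refl
monotone-first≤ {suc N} q mono (fsuc j) = ≤-trans (mono fzero) (monotone-first≤ (q ∘ fsuc) (mono ∘ fsuc) j)

monotone-≤last : ∀ {N} (q : Fin (suc N) → ℕ) → Monotone q → ∀ j → q j ≤ q (fromℕ N)
monotone-≤last {zero} q mono fzero = ≤-refl
monotone-≤last {suc N} q mono fzero = monotone-first≤ q mono (fromℕ (suc N))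
monotone-≤last {suc N} q mono (fsuc j) = monotone-≤last (q ∘ fsuc) (mono ∘ fsuc) j

ValidSub-halfOpen : ∀ {n a b} → 1 ≤ a → a ≤ b → b ≤ suc n → ValidSub n a (b ∸ 1)
ValidSub-halfOpen {b = suc b} 1≤a a≤b (s≤s b≤n) = 1≤a , a≤b , b≤n
ValidSub-halfOpen {b = zero} (s≤s _) () _

admissible-valid : ∀ {n ξ q} → AdmissibleTuple n ξ q → ValidSub n (q fzero) (q (fromℕ ξ) ∸ 1)
admissible-valid {q = q} (1≤q₀ , mono , qξ≤) =
  ValidSub-halfOpen 1≤q₀ (monotone-first≤ q mono (fromℕ _)) qξ≤

admissible-piece-valid : ∀ {n ξ q} → AdmissibleTuple n ξ q →
  ∀ i → ValidSub n (q (inject₁ i)) (q (fsuc i) ∸ 1)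
admissible-piece-valid {q = q} (1≤q₀ , mono , qξ≤) i =
  ValidSub-halfOpen (≤-trans 1≤q₀ (monotone-first≤ q mono _)) (mono i)
    (≤-trans (monotone-≤last q mono (fsuc i)) qξ≤)

sumᶠ : ∀ {N} → (Fin N → ℕ) → ℕ
sumᶠ f = sum (tabulate f)

sumᶠ-mono : ∀ {N} {f g : Fin N → ℕ} → (∀ i → f i ≤ g i) → sumᶠ f ≤ sumᶠ g
sumᶠ-mono {zero} f≤g = z≤n
sumᶠ-mono {suc N} f≤g = +-mono-≤ (f≤g fzero) (sumᶠ-mono (f≤g ∘ fsuc))

sumᶠ-+ : ∀ {N} (f g : Fin N → ℕ) → sumᶠ f + sumᶠ g ≡ sumᶠ (λ i → f i + g i)
sumᶠ-+ {zero} f g = refl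
sumᶠ-+ {suc N} f g = begin
  (f fzero + sumᶠ (f ∘ fsuc)) + (g fzero + sumᶠ (g ∘ fsuc))
    ≡⟨ +-+-swap (f fzero) _ _ _ ⟩
  (f fzero + g fzero) + (sumᶠ (f ∘ fsuc) + sumᶠ (g ∘ fsuc))
    ≡⟨ cong (f fzero + g fzero +_) (sumᶠ-+ (f ∘ fsuc) (g ∘ fsuc)) ⟩
  (f fzero + g fzero) + sumᶠ (λ i → f (fsuc i) + g (fsuc i)) ∎
  where
  open ≡-Reasoning
  +-+-swap : ∀ a b c d → (a + b) + (c + d) ≡ (a + c) + (b + d)
  +-+-swap = solve-∀

sumᶠ-*ˡ : ∀ {N} K (g : Fin N → ℕ) → sumᶠ (λ i → K * g i) ≡ K * sumᶠ g
sumᶠ-*ˡ {zero} K g = sym (*-zeroʳ K)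
sumᶠ-*ˡ {suc N} K g =
  trans (cong (K * g fzero +_) (sumᶠ-*ˡ K (g ∘ fsuc))) (sym (*-distribˡ-+ K (g fzero) _))

sumᶠ-+≤* : ∀ {N} K (f g : Fin N → ℕ) → (∀ i → f i + g i ≤ K * g i) → sumᶠ f + sumᶠ g ≤ K * sumᶠ g
sumᶠ-+≤* K f g pointwise = begin
  sumᶠ f + sumᶠ g        ≡⟨ sumᶠ-+ f g ⟩
  sumᶠ (λ i → f i + g i) ≤⟨ sumᶠ-mono pointwise ⟩
  sumᶠ (λ i → K * g i)   ≡⟨ sumᶠ-*ˡ K g ⟩
  K * sumᶠ g             ∎
  where open ≤-Reasoning

module _ {A : Set} where

  concatᶠ : ∀ {N} → (Fin N → List A) → List A
  concatᶠ T = concat (toList (tabulate T))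

  length-concatᶠ : ∀ {N} m (W : Fin N → List A) → (∀ i → length (W i) ≡ m) →
    length (concatᶠ W) ≡ N * m
  length-concatᶠ {zero} m W lengths = refl
  length-concatᶠ {suc N} m W lengths =
    trans (length-++ (W fzero)) (cong₂ _+_ (lengths fzero) (length-concatᶠ m (W ∘ fsuc) (lengths ∘ fsuc)))

  equal-windows-length : ∀ {N} .{{_ : NonZero N}} {m k} (W : Fin N → List A) →
    (∀ i → length (W i) ≡ m) → length (concatᶠ W) ≤ N ^ suc k → ∀ i → length (W i) ≤ N ^ k
  equal-windows-length {N} {m} W lengths |s|≤ i =
    subst (_≤ _) (sym (lengths i)) (*-cancelˡ-≤ N (subst (_≤ _) (length-concatᶠ m W lengths) |s|≤))

  take-+ : ∀ m n (xs : List A) → take (m + n) xs ≡ take m xs ++ take n (drop m xs)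
  take-+ zero n xs = refl
  take-+ (suc m) zero [] = refl
  take-+ (suc m) (suc n) [] = refl
  take-+ (suc m) n (x ∷ xs) = cong (x ∷_) (take-+ m n xs)

  take≡++ : ∀ L (ys t₁ t₂ : List A) → take L ys ≡ t₁ ++ t₂ →
    length t₁ ≤ L × t₁ ≡ take (length t₁) ys × t₂ ≡ take (L ∸ length t₁) (drop (length t₁) ys)
  take≡++ L ys [] t₂ e = z≤n , refl , sym e
  take≡++ zero ys (t ∷ t₁) t₂ ()
  take≡++ (suc L) [] (t ∷ t₁) t₂ ()
  take≡++ (suc L) (y ∷ ys) (t ∷ t₁) t₂ e with ∷-injective e
  ... | refl , e′ with take≡++ L ys t₁ t₂ e′
  ...   | j≤L , e₁ , e₂ = s≤s j≤L , cong (y ∷_) e₁ , e₂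

  drop-pred-+ : ∀ (x : List A) {a} j → 1 ≤ a → drop (a + j ∸ 1) x ≡ drop j (drop (a ∸ 1) x)
  drop-pred-+ x {a} j 1≤a = trans (cong (λ k → drop k x) (+-∸-comm j 1≤a)) (sym (drop-drop (a ∸ 1) j x))

  sub≡subHO : ∀ (x : List A) {a} b → 1 ≤ a → sub x a (b ∸ 1) ≡ subHO x a b
  sub≡subHO x {suc a} zero _ = cong (λ k → take k (drop a x)) (0∸n≡0 a)
  sub≡subHO x (suc b) _ = refl

  subHO-++ : ∀ (x : List A) {a b c} → 1 ≤ a → a ≤ b → b ≤ c →
    subHO x a c ≡ subHO x a b ++ subHO x b c
  subHO-++ x {a} {b} {c} 1≤a a≤b b≤c = begin
    take (c ∸ a) (drop (a ∸ 1) x)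
      ≡⟨ cong (λ k → take k (drop (a ∸ 1) x)) lengths ⟩
    take ((b ∸ a) + (c ∸ b)) (drop (a ∸ 1) x)
      ≡⟨ take-+ (b ∸ a) (c ∸ b) (drop (a ∸ 1) x) ⟩
    subHO x a b ++ take (c ∸ b) (drop (b ∸ a) (drop (a ∸ 1) x))
      ≡⟨ cong (λ z → subHO x a b ++ take (c ∸ b) z) (drop-drop (a ∸ 1) (b ∸ a) x) ⟩
    subHO x a b ++ take (c ∸ b) (drop ((a ∸ 1) + (b ∸ a)) x)
      ≡⟨ cong (λ k → subHO x a b ++ take (c ∸ b) (drop k x)) offsets ⟩
    subHO x a b ++ subHO x b c ∎
    where
    open ≡-Reasoning
    lengths : c ∸ a ≡ (b ∸ a) + (c ∸ b)
    lengths = trans (cong (_∸ a) (sym (m∸n+n≡m b≤c)))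
                (trans (+-∸-assoc (c ∸ b) a≤b) (+-comm (c ∸ b) (b ∸ a)))
    offsets : (a ∸ 1) + (b ∸ a) ≡ b ∸ 1
    offsets = trans (+-comm (a ∸ 1) (b ∸ a))
                (trans (sym (+-∸-assoc (b ∸ a) 1≤a)) (cong (_∸ 1) (m∸n+n≡m a≤b)))

  subHO-concat : ∀ (x : List A) {N} (q : Fin (suc N) → ℕ) → Monotone q → 1 ≤ q fzero →
    subHO x (q fzero) (q (fromℕ N)) ≡ concatᶠ (λ i → subHO x (q (inject₁ i)) (q (fsuc i)))
  subHO-concat x {zero} q mono _ = cong (λ k → take k (drop (q fzero ∸ 1) x)) (n∸n≡0 (q fzero))
  subHO-concat x {suc N} q mono 1≤q₀ =
    trans (subHO-++ x 1≤q₀ (mono fzero) (monotone-≤last q mono (fsuc fzero)))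
      (cong (subHO x (q fzero) (q (fsuc fzero)) ++_)
        (subHO-concat x (q ∘ fsuc) (mono ∘ fsuc) (≤-trans 1≤q₀ (mono fzero))))

  subHO-cuts : ∀ {N} (x : List A) a L → 1 ≤ a → (T : Fin (suc N) → List A) →
    take L (drop (a ∸ 1) x) ≡ concatᶠ T →
    Σ[ q ∈ (Fin (suc (suc N)) → ℕ) ]
      q fzero ≡ a × q (fromℕ (suc N)) ≡ a + L × Monotone q
      × (∀ i → subHO x (q (inject₁ i)) (q (fsuc i)) ≡ T i)
  subHO-cuts {zero} x a L _ T e = q , refl , refl , (λ { fzero → m≤m+n a L }) , λ { fzero → piece }
    where
    q : Fin 2 → ℕ
    q fzero = a
    q (fsuc _) = a + L
    piece : subHO x a (a + L) ≡ T fzero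
    piece = trans (cong (λ k → take k (drop (a ∸ 1) x)) (m+n∸m≡n a L)) (trans e (++-identityʳ (T fzero)))
  subHO-cuts {suc N} x a L 1≤a T e
    with take≡++ L (drop (a ∸ 1) x) (T fzero) (concatᶠ (T ∘ fsuc)) e
  ... | j≤L , e₁ , e₂
    with subHO-cuts x (a + length (T fzero)) (L ∸ length (T fzero)) (≤-trans 1≤a (m≤m+n a _)) (T ∘ fsuc)
           (trans (cong (take _) (drop-pred-+ x (length (T fzero)) 1≤a)) (sym e₂))
  ... | q′ , q′₀≡ , q′last≡ , mono′ , pieces′ = q , refl , last≡ , mono , pieces
    where
    j = length (T fzero)
    q : Fin (suc (suc (suc N))) → ℕ
    q fzero = a
    q (fsuc i) = q′ i
    last≡ : q′ (fromℕ (suc N)) ≡ a + L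
    last≡ = trans q′last≡ (trans (+-assoc a j (L ∸ j)) (cong (a +_) (m+[n∸m]≡n j≤L)))
    mono : Monotone q
    mono fzero = subst (a ≤_) (sym q′₀≡) (m≤m+n a j)
    mono (fsuc i) = mono′ i
    pieces : ∀ i → subHO x (q (inject₁ i)) (q (fsuc i)) ≡ T i
    pieces fzero = trans (cong (λ b → take (b ∸ a) (drop (a ∸ 1) x)) q′₀≡)
                     (trans (cong (λ k → take k (drop (a ∸ 1) x)) (m+n∸m≡n a j)) (sym e₁))
    pieces (fsuc i) = pieces′ i

module EditDistance {A : Set} (_≟_ : DecidableEquality A) where

  ed≟ : List A → List A → ℕ
  ed≟ = ed _≟_

  cost≟ : A → A → ℕ
  cost≟ = cost _≟_

  data Alignment : List A → List A → ℕ → Set where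
    nil : Alignment [] [] 0
    del : ∀ {x xs ys k} → Alignment xs ys k → Alignment (x ∷ xs) ys (suc k)
    ins : ∀ {y xs ys k} → Alignment xs ys k → Alignment xs (y ∷ ys) (suc k)
    rep : ∀ {x y xs ys k} → Alignment xs ys k → Alignment (x ∷ xs) (y ∷ ys) (cost≟ x y + k)

  cost-sym : ∀ x y → cost≟ x y ≡ cost≟ y x
  cost-sym x y with x ≟ y | y ≟ x
  ... | yes _ | yes _ = refl
  ... | no _  | no _  = refl
  ... | yes x≡y | no y≢x = contradiction (sym x≡y) y≢x
  ... | no x≢y | yes y≡x = contradiction (sym y≡x) x≢y

  cost-triangle : ∀ x y z → cost≟ x z ≤ cost≟ x y + cost≟ y z
  cost-triangle x y z with x ≟ z
  ... | yes _ = z≤n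
  ... | no x≢z with x ≟ y
  ...   | no _ = s≤s z≤n
  ...   | yes refl with x ≟ z
  ...     | yes x≡z = contradiction x≡z x≢z
  ...     | no _ = ≤-refl

  ed-[]ʳ : ∀ xs → ed≟ xs [] ≡ length xs
  ed-[]ʳ [] = refl
  ed-[]ʳ (x ∷ xs) = refl

  ⊓₃-closed : (P : ℕ → Set) {a b c : ℕ} → P a → P b → P c → P ((a ⊓ b) ⊓ c)
  ⊓₃-closed P {a} {b} {c} pa pb pc with ⊓-sel (a ⊓ b) c
  ... | inj₂ e = subst P (sym e) pc
  ... | inj₁ e with ⊓-sel a b
  ...   | inj₁ e′ = subst P (sym (trans e e′)) pa
  ...   | inj₂ e′ = subst P (sym (trans e e′)) pb

  insert-all : ∀ ys → Alignment [] ys (length ys)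
  insert-all [] = nil
  insert-all (y ∷ ys) = ins (insert-all ys)

  delete-all : ∀ xs → Alignment xs [] (length xs)
  delete-all [] = nil
  delete-all (x ∷ xs) = del (delete-all xs)

  ed-alignment : ∀ xs ys → Alignment xs ys (ed≟ xs ys)
  ed-alignment [] ys = insert-all ys
  ed-alignment (x ∷ xs) [] = delete-all (x ∷ xs)
  ed-alignment (x ∷ xs) (y ∷ ys) = ⊓₃-closed (Alignment (x ∷ xs) (y ∷ ys))
    (del (ed-alignment xs (y ∷ ys))) (ins (ed-alignment (x ∷ xs) ys)) (rep (ed-alignment xs ys))

  ed-minimal : ∀ {xs ys k} → Alignment xs ys k → ed≟ xs ys ≤ k
  ed-minimal nil = z≤n
  ed-minimal (del {xs = xs} {ys = []} a) = s≤s (subst (_≤ _) (ed-[]ʳ xs) (ed-minimal a))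
  ed-minimal (del {ys = _ ∷ _} a) = ≤-trans (m⊓n≤m _ _) (≤-trans (m⊓n≤m _ _) (s≤s (ed-minimal a)))
  ed-minimal (ins {xs = []} a) = s≤s (ed-minimal a)
  ed-minimal (ins {xs = _ ∷ _} a) = ≤-trans (m⊓n≤m _ _) (≤-trans (m⊓n≤n _ _) (s≤s (ed-minimal a)))
  ed-minimal (rep {x} {y} a) = ≤-trans (m⊓n≤n _ _) (+-monoʳ-≤ (cost≟ x y) (ed-minimal a))

  alignment-sym : ∀ {xs ys k} → Alignment xs ys k → Alignment ys xs k
  alignment-sym nil = nil
  alignment-sym (del a) = ins (alignment-sym a)
  alignment-sym (ins a) = del (alignment-sym a)
  alignment-sym (rep {x} {y} a) = subst (Alignment _ _) (cong (_+ _) (cost-sym y x)) (rep (alignment-sym a))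

  ed-sym : ∀ xs ys → ed≟ xs ys ≡ ed≟ ys xs
  ed-sym xs ys = ≤-antisym (ed-minimal (alignment-sym (ed-alignment ys xs)))
                           (ed-minimal (alignment-sym (ed-alignment xs ys)))

  alignment-compose : ∀ {xs ys zs a b} → Alignment xs ys a → Alignment ys zs b →
    Σ[ c ∈ ℕ ] Alignment xs zs c × c ≤ a + b
  alignment-compose {a = a} p nil = a , p , m≤m+n a 0
  alignment-compose {a = a} p (ins {k = b} q) with alignment-compose p q
  ... | c , r , c≤ = suc c , ins r , ≤-trans (s≤s c≤) (≤-reflexive (sym (+-suc a b)))
  alignment-compose (ins p) (del q) with alignment-compose p q
  ... | c , r , c≤ = c , r , ≤-trans c≤ (+-mono-≤ (n≤1+n _) (n≤1+n _))
  alignment-compose (del p) q@(del _) with alignment-compose p q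
  ... | c , r , c≤ = suc c , del r , s≤s c≤
  alignment-compose (rep {x} {y} {k = a} p) (del {k = b} q) with alignment-compose p q
  ... | c , r , c≤ = suc c , del r ,
        ≤-trans (s≤s c≤) (≤-trans (≤-reflexive (sym (+-suc a b))) (+-monoˡ-≤ (suc b) (m≤n+m a (cost≟ x y))))
  alignment-compose (ins {k = a} p) (rep {x = y} {y = z} {k = b} q) with alignment-compose p q
  ... | c , r , c≤ = suc c , ins r , s≤s (≤-trans c≤ (+-monoʳ-≤ a (m≤n+m b (cost≟ y z))))
  alignment-compose (del p) q@(rep _) with alignment-compose p q
  ... | c , r , c≤ = suc c , del r , s≤s c≤
  alignment-compose (rep {x} {y} {k = a} p) (rep {y = z} {k = b} q) with alignment-compose p q
  ... | c , r , c≤ = cost≟ x z + c , rep r ,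
        ≤-trans (+-mono-≤ (cost-triangle x y z) c≤) (≤-reflexive (interchange (cost≟ x y) (cost≟ y z) a b))
    where
    interchange : ∀ e f a b → (e + f) + (a + b) ≡ (e + a) + (f + b)
    interchange = solve-∀

  ed-triangle : ∀ xs ys zs → ed≟ xs zs ≤ ed≟ xs ys + ed≟ ys zs
  ed-triangle xs ys zs with alignment-compose (ed-alignment xs ys) (ed-alignment ys zs)
  ... | c , r , c≤ = ≤-trans (ed-minimal r) c≤

  alignment-++ : ∀ {xs xs′ ys ys′ k k′} → Alignment xs ys k → Alignment xs′ ys′ k′ →
    Alignment (xs ++ xs′) (ys ++ ys′) (k + k′)
  alignment-++ nil q = q
  alignment-++ (del p) q = del (alignment-++ p q)
  alignment-++ (ins p) q = ins (alignment-++ p q)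
  alignment-++ (rep {x} {y} {k = k} p) q =
    subst (Alignment _ _) (sym (+-assoc (cost≟ x y) k _)) (rep (alignment-++ p q))

  ed-concatᶠ : ∀ {N} (T U : Fin N → List A) → ed≟ (concatᶠ T) (concatᶠ U) ≤ sumᶠ (λ i → ed≟ (T i) (U i))
  ed-concatᶠ T U = ed-minimal (alignment-concatᶠ T U)
    where
    alignment-concatᶠ : ∀ {N} (T U : Fin N → List A) →
      Alignment (concatᶠ T) (concatᶠ U) (sumᶠ (λ i → ed≟ (T i) (U i)))
    alignment-concatᶠ {zero} T U = nil
    alignment-concatᶠ {suc N} T U =
      alignment-++ (ed-alignment (T fzero) (U fzero)) (alignment-concatᶠ (T ∘ fsuc) (U ∘ fsuc))

  alignment-split : ∀ us vs {ts k} → Alignment ts (us ++ vs) k →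
    ∃₂ λ ts₁ ts₂ → ts ≡ ts₁ ++ ts₂ × ed≟ ts₁ us + ed≟ ts₂ vs ≤ k
  alignment-split [] vs {ts} a = [] , ts , refl , ed-minimal a
  alignment-split (u ∷ us) vs (del {x} a) with alignment-split (u ∷ us) vs a
  ... | ts₁ , ts₂ , refl , ≤k = x ∷ ts₁ , ts₂ , refl ,
        ≤-trans (+-monoˡ-≤ _ (ed-minimal (del (ed-alignment ts₁ (u ∷ us))))) (s≤s ≤k)
  alignment-split (u ∷ us) vs (ins a) with alignment-split us vs a
  ... | ts₁ , ts₂ , refl , ≤k = ts₁ , ts₂ , refl ,
        ≤-trans (+-monoˡ-≤ _ (ed-minimal (ins {y = u} (ed-alignment ts₁ us)))) (s≤s ≤k)
  alignment-split (u ∷ us) vs (rep {x} a) with alignment-split us vs a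
  ... | ts₁ , ts₂ , refl , ≤k = x ∷ ts₁ , ts₂ , refl ,
        ≤-trans (+-monoˡ-≤ _ (ed-minimal (rep {x = x} {y = u} (ed-alignment ts₁ us))))
          (≤-trans (≤-reflexive (+-assoc (cost≟ x u) _ _)) (+-monoʳ-≤ (cost≟ x u) ≤k))

  ed-split-concatᶠ : ∀ {N} ts (U : Fin (suc N) → List A) →
    Σ[ T ∈ (Fin (suc N) → List A) ] ts ≡ concatᶠ T × sumᶠ (λ i → ed≟ (T i) (U i)) ≤ ed≟ ts (concatᶠ U)
  ed-split-concatᶠ {zero} ts U =
    (λ _ → ts) , sym (++-identityʳ ts) ,
    ≤-reflexive (trans (+-identityʳ _) (cong (ed≟ ts) (sym (++-identityʳ (U fzero)))))
  ed-split-concatᶠ {suc N} ts U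
    with alignment-split (U fzero) (concatᶠ (U ∘ fsuc)) (ed-alignment ts (concatᶠ U))
  ... | ts₁ , ts₂ , refl , ≤ed with ed-split-concatᶠ ts₂ (U ∘ fsuc)
  ... | T , refl , ≤ed₂ = T′ , refl , ≤-trans (+-monoʳ-≤ (ed≟ ts₁ (U fzero)) ≤ed₂) ≤ed
    where
    T′ : Fin (suc (suc N)) → List A
    T′ fzero = ts₁
    T′ (fsuc i) = T i

+≤*-upward : ∀ {Y E e K} → Y + E ≤ K * E → E ≤ e → 1 ≤ K → Y + e ≤ K * e
+≤*-upward {Y} {E} {e} {K} bound E≤e 1≤K = begin
  Y + e               ≡⟨ cong (Y +_) (sym (m+[n∸m]≡n E≤e)) ⟩
  Y + (E + (e ∸ E))   ≡⟨ sym (+-assoc Y E (e ∸ E)) ⟩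
  (Y + E) + (e ∸ E)   ≤⟨ +-mono-≤ bound (m≤n*m (e ∸ E) K {{>-nonZero 1≤K}}) ⟩
  K * E + K * (e ∸ E) ≡⟨ sym (*-distribˡ-+ K E (e ∸ E)) ⟩
  K * (E + (e ∸ E))   ≡⟨ cong (K *_) (m+[n∸m]≡n E≤e) ⟩
  K * e               ∎
  where open ≤-Reasoning

doubling-via-triangle : ∀ {d e e′} B → e′ ≤ e + d → d + e ≤ B * e → (d + e′) + e ≤ 2 * B * e
doubling-via-triangle {d} {e} {e′} B e′≤ bound = begin
  (d + e′) + e      ≤⟨ +-monoˡ-≤ e (+-monoʳ-≤ d e′≤) ⟩
  (d + (e + d)) + e ≡⟨ doubled d e ⟩
  2 * (d + e)       ≤⟨ *-monoʳ-≤ 2 bound ⟩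
  2 * (B * e)       ≡⟨ sym (*-assoc 2 B e) ⟩
  2 * B * e         ∎
  where
  open ≤-Reasoning
  doubled : ∀ a b → (a + (b + a)) + b ≡ 2 * (a + b)
  doubled = solve-∀

module Approximation {A : Set} (_≟_ : DecidableEquality A) (ξ′ : ℕ) (s̄ : List A) where
  open EditDistance _≟_

  ξ : ℕ
  ξ = suc ξ′

  open Algorithm _≟_ ξ s̄

  left right value : Triple → ℕ
  left (l , _ , _) = l
  right (_ , r , _) = r
  value (_ , _ , d) = d

  reported : Triple → List A
  reported o = sub s̄ (left o) (right o)

  piece : (Fin (suc ξ) → ℕ) → Fin ξ → List A
  piece p i = subHO s̄ (p (inject₁ i)) (p (fsuc i))

  Within : ℕ → List A → ℕ → Set
  Within k s d = ∀ l* r* → ValidSub n l* r* →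
    d + ed≟ (sub s̄ l* r*) s ≤ 2 ^ suc k * ed≟ (sub s̄ l* r*) s

  record Guarantee (s : List A) (o : Triple) : Set where
    field
      valid  : ValidSub n (left o) (right o)
      upper  : ed≟ (reported o) s ≤ value o
      within : ∀ k → length s ≤ ξ ^ k → Within k s (value o)

  base-within : ∀ {s d} k → (∀ l* r* → ValidSub n l* r* → d ≤ ed≟ (sub s̄ l* r*) s) → Within k s d
  base-within {s} {d} k optimal l* r* v = begin
    d + e         ≤⟨ +-monoˡ-≤ e (optimal l* r* v) ⟩
    e + e         ≡⟨ cong (e +_) (sym (+-identityʳ e)) ⟩
    2 * e         ≤⟨ *-monoˡ-≤ e (*-monoʳ-≤ 2 (m^n>0 2 k)) ⟩
    2 ^ suc k * e ∎
    where
    open ≤-Reasoning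
    e = ed≟ (sub s̄ l* r*) s

  split-upper : (W : Fin ξ → List A) (os : Vec Triple ξ) {p : Fin (suc ξ) → ℕ} → 1 ≤ p fzero → Monotone p →
    (∀ i → ed≟ (reported (lookup os i)) (W i) ≤ value (lookup os i)) →
    ed≟ (sub s̄ (p fzero) (p (fromℕ ξ) ∸ 1)) (concatᶠ W) ≤ dist os p
  split-upper W os {p} 1≤p₀ mono upper = begin
    ed≟ (sub s̄ (p fzero) (p (fromℕ ξ) ∸ 1)) (concatᶠ W)
      ≡⟨ cong (λ t → ed≟ t (concatᶠ W)) (trans (sub≡subHO s̄ _ 1≤p₀) (subHO-concat s̄ p mono 1≤p₀)) ⟩
    ed≟ (concatᶠ (piece p)) (concatᶠ W)
      ≤⟨ ed-concatᶠ (piece p) W ⟩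
    sumᶠ (λ i → ed≟ (piece p i) (W i))
      ≤⟨ sumᶠ-mono via-reported ⟩
    dist os p ∎
    where
    open ≤-Reasoning
    via-reported : ∀ i → ed≟ (piece p i) (W i) ≤ value (lookup os i) + ed≟ (piece p i) (reported (lookup os i))
    via-reported i = ≤-trans (ed-triangle (piece p i) (reported (lookup os i)) (W i))
      (≤-trans (+-monoʳ-≤ _ (upper i)) (≤-reflexive (+-comm _ (value (lookup os i)))))

  admissible-split : (W : Fin ξ → List A) {l* r* : ℕ} → ValidSub n l* r* →
    Σ[ q ∈ (Fin (suc ξ) → ℕ) ] AdmissibleTuple n ξ q
      × sumᶠ (λ i → ed≟ (piece q i) (W i)) ≤ ed≟ (sub s̄ l* r*) (concatᶠ W)
  admissible-split W {l*} {r*} (1≤l , l≤1+r , r≤n) with ed-split-concatᶠ (sub s̄ l* r*) W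
  ... | T , t≡T , ΣT≤ with subHO-cuts s̄ l* (suc r* ∸ l*) 1≤l T t≡T
  ... | q , q₀≡l , qξ≡ , mono , pieces =
    q , (subst (1 ≤_) (sym q₀≡l) 1≤l , mono , subst (_≤ suc n) (sym qξ≡′) (s≤s r≤n)) ,
    ≤-trans (sumᶠ-mono (λ i → ≤-reflexive (cong (λ t → ed≟ t (W i)) (pieces i)))) ΣT≤
    where
    qξ≡′ : q (fromℕ ξ) ≡ suc r*
    qξ≡′ = trans qξ≡ (m+[n∸m]≡n l≤1+r)

  split-within : ∀ k (W : Fin ξ → List A) (os : Vec Triple ξ) (p : Fin (suc ξ) → ℕ) →
    (∀ i → ed≟ (reported (lookup os i)) (W i) ≤ value (lookup os i)) →
    (∀ i → Within k (W i) (value (lookup os i))) →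
    (∀ p′ → AdmissibleTuple n ξ p′ → dist os p ≤ dist os p′) →
    Within (suc k) (concatᶠ W) (dist os p)
  split-within k W os p upper within optimal l* r* v with admissible-split W v
  ... | q , adm , Σe≤ed* =
    ≤-trans (+-monoˡ-≤ _ (optimal q adm))
      (+≤*-upward (sumᶠ-+≤* (2 ^ suc (suc k)) f e pointwise) Σe≤ed* (m^n>0 2 (suc (suc k))))
    where
    d : Fin ξ → ℕ
    d i = value (lookup os i)
    e : Fin ξ → ℕ
    e i = ed≟ (piece q i) (W i)
    f : Fin ξ → ℕ
    f i = d i + ed≟ (piece q i) (reported (lookup os i))
    window-bound : ∀ i → d i + e i ≤ 2 ^ suc k * e i
    window-bound i with admissible-piece-valid {q = q} adm i
    ... | v@(1≤qᵢ , _) = subst (λ t → d i + ed≟ t (W i) ≤ 2 ^ suc k * ed≟ t (W i))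
                            (sub≡subHO s̄ (q (fsuc i)) 1≤qᵢ) (within i _ _ v)
    via-window : ∀ i → ed≟ (piece q i) (reported (lookup os i)) ≤ e i + d i
    via-window i = ≤-trans (ed-triangle (piece q i) (W i) (reported (lookup os i)))
      (+-monoʳ-≤ (e i) (≤-trans (≤-reflexive (ed-sym (W i) _)) (upper i)))
    pointwise : ∀ i → f i + e i ≤ 2 ^ suc (suc k) * e i
    pointwise i = doubling-via-triangle (2 ^ suc k) (via-window i) (window-bound i)

  split-guarantee : ∀ {m} (W : Fin ξ → List A) (os : Vec Triple ξ) (p : Fin (suc ξ) → ℕ) →
    ξ < length (concatᶠ W) → (∀ i → length (W i) ≡ m) → (∀ i → Guarantee (W i) (lookup os i)) →
    AdmissibleTuple n ξ p → (∀ p′ → AdmissibleTuple n ξ p′ → dist os p ≤ dist os p′) →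
    Guarantee (concatᶠ W) (p fzero , p (fromℕ ξ) ∸ 1 , dist os p)
  split-guarantee W os p ξ<|s| lengths IH adm@(1≤p₀ , mono , _) optimal = record
    { valid  = admissible-valid {q = p} adm
    ; upper  = split-upper W os {p} 1≤p₀ mono (Guarantee.upper ∘ IH)
    ; within = λ where
        zero |s|≤1 → contradiction |s|≤1 (<⇒≱ (≤-trans (s≤s (s≤s z≤n)) ξ<|s|))
        (suc k) |s|≤ → split-within k W os p (Guarantee.upper ∘ IH)
          (λ i → Guarantee.within (IH i) k (equal-windows-length {k = k} W lengths |s|≤ i)) optimal
    }

  guarantee : ∀ {s o} → Out s o → Guarantee s o
  guarantee (base _ valid optimal) = record
    { valid = valid ; upper = ≤-refl ; within = λ k _ → base-within k optimal }
  guarantee (split _ ws os p ξ<|s| refl lengths outs adm optimal) =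
    subst (λ s → Guarantee s _) (sym concat-lookup)
      (split-guarantee (lookup ws) os p (subst (λ s → ξ < length s) concat-lookup ξ<|s|)
        lengths (λ i → guarantee (outs i)) adm optimal)
    where
    concat-lookup : concat (toList ws) ≡ concatᶠ (lookup ws)
    concat-lookup = cong (concat ∘ toList) (sym (tabulate∘lookup ws))

-- The hypothesis 2 ≤ ξ is only needed to rule out ξ = 0.
theorem3 : Σ ℕ λ C → {A : Set} (_≟_ : DecidableEquality A) (ξ : ℕ) → 2 ≤ ξ
    → (s̄ s : List A) (l r d : ℕ) → Algorithm.Out _≟_ ξ s̄ s (l , r , d)
    → ValidSub (length s̄) l r
      × ed _≟_ (sub s̄ l r) s ≤ d
      × ((k : ℕ) → length s ≤ ξ ^ k → (l* r* : ℕ) → ValidSub (length s̄) l* r*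
         → d ≤ C * 2 ^ k * ed _≟_ (sub s̄ l* r*) s)
theorem3 = 2 , λ where
  _≟_ (suc ξ′) _ s̄ s l r d out →
    let open Approximation.Guarantee (Approximation.guarantee _≟_ ξ′ s̄ out) in
    valid , upper , λ k |s|≤ l* r* v → ≤-trans (m≤m+n d _) (within k |s|≤ l* r* v)
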